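{- Let $N$ be a binary matroid and $a \in E(N)$ such that $N \backslash a \cong F_7$. If $N/a$ has no minor isomorphic to $F_7$ or $F_7^*$, then $N/a$ is graphic.
   Context: $F_7$ is the Fano matroid and $F_7^*$ its dual. The matroid $N/a$ with $N\backslash a \cong F$ is called an elementary quotient of $F$. -}

module Defs where

open import Data.Nat using (ℕ; zero; suc; _<_)
open import Data.Bool using (Bool; true; false; _∧_; _xor_)
open import Data.Fin using (Fin; zero; suc; fromℕ; inject₁)
open import Data.Fin.Subset using (Subset; ⊥; ⁅_⁆; _∪_; _∈_; _∉_; _⊆_; ∁; ∣_∣)
open import Data.Fin.Permutation using (Permutation; _⟨$⟩ˡ_)
open import Data.Vec using (Vec; []; _∷_; lookup; tabulate; insertAt; foldr′; zipWith)
open import Data.Product using (Σ; ∃; _×_; _,_)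
open import Data.Sum using (_⊎_)
open import Relation.Nullary using (¬_)
open import Relation.Binary.PropositionalEquality using (_≡_)
open import Function.Definitions using (Injective)

-- A set system on ground set Fin n, given by its "independent sets" predicate.
SetSystem : ℕ → Set₁
SetSystem n = Subset n → Set

record IsMatroid {n : ℕ} (M : SetSystem n) : Set where
  field
    indep-∅   : M ⊥
    indep-⊆   : ∀ X Y → Y ⊆ X → M X → M Y
    augment   : ∀ X Y → M X → M Y → ∣ X ∣ < ∣ Y ∣ →
                ∃ λ x → x ∈ Y × x ∉ X × M (X ∪ ⁅ x ⁆)

-- Deletion M \ a : independent sets of M avoiding a (ground set relabelled to Fin n).
del : {n : ℕ} → SetSystem (suc n) → Fin (suc n) → SetSystem n
del M a X = M (insertAt X a false)

-- Contraction M / a : X is independent iff X is independent in M and,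
-- when {a} is independent (a not a loop), X ∪ {a} is independent in M.
con : {n : ℕ} → SetSystem (suc n) → Fin (suc n) → SetSystem n
con M a X = M (insertAt X a false) × (M ⁅ a ⁆ → M (insertAt X a true))

data _≼_ : {m n : ℕ} → SetSystem m → SetSystem n → Set₁ where
  self  : {m : ℕ} {M : SetSystem m} → M ≼ M
  viaDel : {m n : ℕ} {M : SetSystem m} {N : SetSystem (suc n)} (a : Fin (suc n)) →
           M ≼ del N a → M ≼ N
  viaCon : {m n : ℕ} {M : SetSystem m} {N : SetSystem (suc n)} (a : Fin (suc n)) →
           M ≼ con N a → M ≼ N

relabel : {m n : ℕ} → Permutation m n → Subset m → Subset n
relabel π X = tabulate (λ j → lookup X (π ⟨$⟩ˡ j))

_≅_ : {m n : ℕ} → SetSystem m → SetSystem n → Set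
_≅_ {m} {n} M N = Σ (Permutation m n) λ π →
  ∀ X → (M X → N (relabel π X)) × (N (relabel π X) → M X)

HasMinorIso : {m n : ℕ} → SetSystem m → SetSystem n → Set₁
HasMinorIso {m} M F = Σ ℕ λ k → Σ (SetSystem k) λ M' → (M' ≼ M) × (M' ≅ F)

-- Vector matroid of a matrix over GF(2) (Bool with xor as addition):
-- a set of columns X is independent iff the only subset Y ⊆ X whose
-- columns sum to zero is the empty set (linear independence over GF(2)).
colSum : {r n : ℕ} → (Fin r → Fin n → Bool) → Subset n → Fin r → Bool
colSum A Y i = foldr′ _xor_ false (zipWith _∧_ Y (tabulate (A i)))

VecMatroid : {r n : ℕ} → (Fin r → Fin n → Bool) → SetSystem n
VecMatroid A X = ∀ Y → Y ⊆ X → (∀ i → colSum A Y i ≡ false) → Y ≡ ⊥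

Binary : {n : ℕ} → SetSystem n → Set
Binary {n} M = Σ ℕ λ r → Σ (Fin r → Fin n → Bool) λ A →
  ∀ X → (M X → VecMatroid A X) × (VecMatroid A X → M X)

-- Fano matroid: columns are the 7 nonzero vectors of GF(2)^3.
fanoRows : Vec (Vec Bool 7) 3
fanoRows = (true  ∷ false ∷ true  ∷ false ∷ true  ∷ false ∷ true  ∷ [])
         ∷ (false ∷ true  ∷ true  ∷ false ∷ false ∷ true  ∷ true  ∷ [])
         ∷ (false ∷ false ∷ false ∷ true  ∷ true  ∷ true  ∷ true  ∷ [])
         ∷ []

F7 : SetSystem 7
F7 = VecMatroid (λ i j → lookup (lookup fanoRows i) j)

IsBasis : {n : ℕ} → SetSystem n → Subset n → Set
IsBasis M B = M B × (∀ x → x ∉ B → ¬ M (B ∪ ⁅ x ⁆))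

dual : {n : ℕ} → SetSystem n → SetSystem n
dual M X = ∃ λ B → IsBasis M B × X ⊆ ∁ B

F7* : SetSystem 7
F7* = dual F7

-- Graphs (multigraphs, loops allowed) with v vertices and edge set Fin n.
record Graph (n : ℕ) : Set where
  field
    nV   : ℕ
    ends : Fin n → Fin nV × Fin nV

Joins : {n : ℕ} (G : Graph n) → Fin n → Fin (Graph.nV G) → Fin (Graph.nV G) → Set
Joins G e x y = (Graph.ends G e ≡ (x , y)) ⊎ (Graph.ends G e ≡ (y , x))

-- A cycle of length suc k inside edge set X: distinct edges es i,
-- closed walk ws 0, ws 1, …, ws (k+1) = ws 0 with ws 0 … ws k distinct,
-- and edge es i joining ws i and ws (i+1).
record Cycle {n : ℕ} (G : Graph n) (X : Subset n) (k : ℕ) : Set where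
  field
    es      : Fin (suc k) → Fin n
    ws      : Fin (suc (suc k)) → Fin (Graph.nV G)
    es-inj  : Injective _≡_ _≡_ es
    ws-inj  : Injective _≡_ _≡_ (λ i → ws (inject₁ i))
    closed  : ws (fromℕ (suc k)) ≡ ws zero
    es-in   : ∀ i → es i ∈ X
    joins   : ∀ i → Joins G (es i) (ws (inject₁ i)) (ws (suc i))

CycleMatroid : {n : ℕ} → Graph n → SetSystem n
CycleMatroid G X = ¬ (Σ ℕ λ k → Cycle G X k)

Graphic : {n : ℕ} → SetSystem n → Set
Graphic {n} M = Σ (Graph n) λ G →
  ∀ X → (M X → CycleMatroid G X) × (CycleMatroid G X → M X)

-- Represent N over GF(2) by a matrix A. The columns of N \ a are the seven points of the Fano
-- plane: any two of them are independent and their sum is the third point of their line, so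
-- together with 0 they are closed under addition. Hence the column of a is either 0 (a is a
-- loop), or parallel to the column of some e, or outside the span of all other columns (a is a
-- coloop). For a loop or a coloop, N / a = N \ a ≅ F₇, which is excluded. In the parallel case
-- N / a is F₇ / e with e kept as a loop, and contracting a point of the Fano plane identifies
-- the points on each of the three lines through it: what is left is the cycle matroid of a
-- triangle with doubled edges, plus a loop.
module Submission where

open import Defs
open import Algebra.Bundles using (CommutativeRing)
open import Data.Bool using (Bool; true; false; _xor_; _∨_; _≟_)
open import Data.Bool.Properties using (xor-∧-commutativeRing; xor-same; xor-identityʳ; xor-assoc; ∨-identityʳ)
open import Algebra.Properties.CommutativeSemigroup
  (CommutativeRing.+-commutativeSemigroup xor-∧-commutativeRing) using (x∙yz≈y∙xz)
open import Data.Empty using () renaming (⊥ to Empty)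
open import Data.Fin using (Fin; zero; suc; punchIn; punchOut; inject₁) renaming (_≟_ to _≟ᶠ_)
open import Data.Fin.Permutation using (Permutation; _⟨$⟩ʳ_; _⟨$⟩ˡ_; inverseˡ; inverseʳ; flip)
open import Data.Fin.Properties using (all?; any?; punchIn-injective; punchIn-punchOut)
open import Data.Fin.Subset using (Subset; ⊥; ⁅_⁆; _∪_; _∈_; _∉_; _⊆_; _-_; _─_; ∣_∣; inside)
open import Data.Fin.Subset.Properties
  using (_∈?_; _⊆?_; anySubset?; ∉⊥; x∈⁅x⁆; x∈⁅y⁆⇒x≡y; x∈p∪q⁺; x∈p∪q⁻; p⊆p∪q; ⊆-antisym; ⊆-min;
         ∪-identityˡ; ∪-identityʳ; x∈p∧x≢y⇒x∈p-y; p─q⊆p)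
open import Data.List using (List; []; _∷_)
open import Data.Maybe using (Maybe; just; nothing)
open import Data.Maybe.Properties using (just-injective) renaming (≡-dec to ≡-decₘ)
open import Data.Nat using (ℕ; zero; suc; _≤_; _≤?_) renaming (_≟_ to _≟ℕ_)
open import Data.Product using (Σ; ∃; _×_; _,_; proj₁; proj₂)
open import Data.Product.Function.NonDependent.Propositional using (_×-⇔_)
open import Data.Sum using (_⊎_; inj₁; inj₂; [_,_]′)
import Data.Sum as Sum
open import Data.Unit using (tt)
open import Data.Vec using (Vec; []; _∷_; here; there; lookup; insertAt)
open import Data.Vec.Properties using (≡-dec; lookup∘tabulate; []=⇒lookup; lookup⇒[]=; insertAt-lookup; insertAt-punchIn)
open import Data.List.Membership.DecPropositional (≡-dec {n = 7} _≟_) using () renaming (_∉_ to _∉ₗ_; _∈?_ to _∈ₗ?_)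
open import Function using (id; _∘_; const; case_of_; _⇔_; mk⇔; Equivalence; Injection)
open import Function.Definitions using (Injective)
open import Function.Properties.Inverse using (↔⇒↣)
import Function.Properties.Equivalence as ⇔
open import Function.Related.Propositional using (module EquationalReasoning)
open import Function.Related.TypeIsomorphisms using (¬-cong-⇔)
open import Relation.Nullary using (¬_; Dec; yes; no; contradiction)
open import Relation.Nullary.Decidable using (_×-dec_; _⊎-dec_; _→-dec_; ¬?; map; decidable-stable; toWitness)
open import Relation.Binary.PropositionalEquality hiding ([_])

private variable
  m n r : ℕ

xor≡false⇒≡ : ∀ {a b} → a xor b ≡ false → a ≡ b
xor≡false⇒≡ {a} {b} eq = begin
  a                ≡⟨ sym (xor-identityʳ a) ⟩
  a xor false      ≡⟨ cong (a xor_) (sym (xor-same b)) ⟩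
  a xor (b xor b)  ≡⟨ sym (xor-assoc a b b) ⟩
  (a xor b) xor b  ≡⟨ cong (_xor b) eq ⟩
  b                ∎
  where open ≡-Reasoning

≡⇒⇔ : ∀ {A : Set} (P : A → Set) {x y} → x ≡ y → P x ⇔ P y
≡⇒⇔ P refl = ⇔.refl

_⇔-dec_ : ∀ {A B : Set} → Dec A → Dec B → Dec (A ⇔ B)
a? ⇔-dec b? = map (mk⇔ (λ (f , g) → mk⇔ f g) (λ e → Equivalence.to e , Equivalence.from e))
                  ((a? →-dec b?) ×-dec (b? →-dec a?))

allSubsets? : {P : Subset n → Set} → (∀ X → Dec (P X)) → Dec (∀ X → P X)
allSubsets? P? = map (mk⇔ (λ ¬cex X → decidable-stable (P? X) (λ ¬PX → ¬cex (X , ¬PX)))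
                          (λ ∀P (X , ¬PX) → ¬PX (∀P X)))
                     (¬? (anySubset? (¬? ∘ P?)))

Disjoint : Subset n → Subset n → Set
Disjoint Y Z = ∀ {x} → x ∈ Y → x ∉ Z

Disjoint-∷⁻ : ∀ {y z} {Y Z : Subset n} → Disjoint (y ∷ Y) (z ∷ Z) → Disjoint Y Z
Disjoint-∷⁻ disj x∈Y x∈Z = disj (there x∈Y) (there x∈Z)

x∈p─q⇒x∉q : (p q : Subset n) → Disjoint (p ─ q) q
x∈p─q⇒x∉q (s ∷ p) (inside ∷ q) () here
x∈p─q⇒x∉q (s ∷ p) (t ∷ q) (there x∈p─q) (there x∈q) = x∈p─q⇒x∉q p q x∈p─q x∈q

x∈p⇒p≡p-x∪⁅x⁆ : ∀ {x} (p : Subset n) → x ∈ p → p ≡ (p - x) ∪ ⁅ x ⁆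
x∈p⇒p≡p-x∪⁅x⁆ {x = x} p x∈p = ⊆-antisym split join
  where
  split : p ⊆ (p - x) ∪ ⁅ x ⁆
  split {y} y∈p with y ≟ᶠ x
  ... | yes refl = x∈p∪q⁺ (inj₂ (x∈⁅x⁆ y))
  ... | no y≢x   = x∈p∪q⁺ (inj₁ (x∈p∧x≢y⇒x∈p-y y∈p y≢x))
  join : (p - x) ∪ ⁅ x ⁆ ⊆ p
  join y∈ with x∈p∪q⁻ (p - x) ⁅ x ⁆ y∈
  ... | inj₁ y∈p-x = p─q⊆p p ⁅ x ⁆ y∈p-x
  ... | inj₂ y∈⁅x⁆ = subst (_∈ p) (sym (x∈⁅y⁆⇒x≡y x y∈⁅x⁆)) x∈p

⁅⁆-disjoint : ∀ {f g : Fin n} → f ≢ g → Disjoint ⁅ f ⁆ ⁅ g ⁆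
⁅⁆-disjoint {f = f} {g} f≢g x∈f x∈g = f≢g (trans (sym (x∈⁅y⁆⇒x≡y f x∈f)) (x∈⁅y⁆⇒x≡y g x∈g))

∈-pair⁺ : ∀ {f g y : Fin n} → y ≡ f ⊎ y ≡ g → y ∈ ⁅ f ⁆ ∪ ⁅ g ⁆
∈-pair⁺ {f = f} (inj₁ refl) = x∈p∪q⁺ (inj₁ (x∈⁅x⁆ f))
∈-pair⁺ {g = g} (inj₂ refl) = x∈p∪q⁺ (inj₂ (x∈⁅x⁆ g))

∈-triple⁻ : ∀ {f g h y : Fin n} → y ∈ ⁅ f ⁆ ∪ ⁅ g ⁆ ∪ ⁅ h ⁆ → y ≡ f ⊎ y ≡ g ⊎ y ≡ h
∈-triple⁻ {f = f} {g} {h} y∈ with x∈p∪q⁻ ⁅ f ⁆ _ y∈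
... | inj₁ y∈f = inj₁ (x∈⁅y⁆⇒x≡y f y∈f)
... | inj₂ y∈gh with x∈p∪q⁻ ⁅ g ⁆ ⁅ h ⁆ y∈gh
...   | inj₁ y∈g = inj₂ (inj₁ (x∈⁅y⁆⇒x≡y g y∈g))
...   | inj₂ y∈h = inj₂ (inj₂ (x∈⁅y⁆⇒x≡y h y∈h))

insertAt-⊥ : (a : Fin (suc n)) → insertAt ⊥ a false ≡ ⊥
insertAt-⊥             zero    = refl
insertAt-⊥ {n = suc n} (suc a) = cong (false ∷_) (insertAt-⊥ a)

insertAt-∪ : (X Y : Subset n) (a : Fin (suc n)) → insertAt (X ∪ Y) a false ≡ insertAt X a false ∪ insertAt Y a false
insertAt-∪ X       Y       zero    = refl
insertAt-∪ (x ∷ X) (y ∷ Y) (suc a) = cong ((x ∨ y) ∷_) (insertAt-∪ X Y a)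

insertAt-⁅⁆ : (f : Fin n) (a : Fin (suc n)) → insertAt ⁅ f ⁆ a false ≡ ⁅ punchIn a f ⁆
insertAt-⁅⁆ f       zero    = refl
insertAt-⁅⁆ zero    (suc a) = cong (true ∷_) (insertAt-⊥ a)
insertAt-⁅⁆ (suc f) (suc a) = cong (false ∷_) (insertAt-⁅⁆ f a)

insertAt-true : (X : Subset n) (a : Fin (suc n)) → insertAt X a true ≡ insertAt X a false ∪ ⁅ a ⁆
insertAt-true X       zero    = cong (true ∷_) (sym (∪-identityʳ X))
insertAt-true (x ∷ X) (suc a) = cong₂ _∷_ (sym (∨-identityʳ x)) (insertAt-true X a)

∉-insertAt : (X : Subset n) (a : Fin (suc n)) → a ∉ insertAt X a false
∉-insertAt X a a∈ = contradiction (trans (sym (insertAt-lookup X a false)) ([]=⇒lookup a∈)) λ ()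

∈⇔punchIn-∈-insertAt : (X : Subset n) (a : Fin (suc n)) {j : Fin n} → j ∈ X ⇔ punchIn a j ∈ insertAt X a false
∈⇔punchIn-∈-insertAt X a {j} = mk⇔
  (λ j∈ → lookup⇒[]= _ _ (trans (insertAt-punchIn X a false j) ([]=⇒lookup j∈)))
  (λ j∈ → lookup⇒[]= _ _ (trans (sym (insertAt-punchIn X a false j)) ([]=⇒lookup j∈)))

module _ (π : Permutation n m) where

  ∈-relabel⁺ : ∀ {X x} → π ⟨$⟩ˡ x ∈ X → x ∈ relabel π X
  ∈-relabel⁺ {X} {x} x∈ = lookup⇒[]= x _ (trans (lookup∘tabulate _ x) ([]=⇒lookup x∈))

  ∈-relabel⁻ : ∀ {X x} → x ∈ relabel π X → π ⟨$⟩ˡ x ∈ X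
  ∈-relabel⁻ {X} {x} x∈ = lookup⇒[]= _ X (trans (sym (lookup∘tabulate _ x)) ([]=⇒lookup x∈))

  ∈-relabel-image : ∀ {X e} → e ∈ X → π ⟨$⟩ʳ e ∈ relabel π X
  ∈-relabel-image {X} e∈X = ∈-relabel⁺ (subst (_∈ X) (sym (inverseˡ π)) e∈X)

  relabel-∪ : ∀ X Y → relabel π (X ∪ Y) ≡ relabel π X ∪ relabel π Y
  relabel-∪ X Y = ⊆-antisym
    (λ x∈ → [ x∈p∪q⁺ ∘ inj₁ ∘ ∈-relabel⁺ , x∈p∪q⁺ ∘ inj₂ ∘ ∈-relabel⁺ ]′ (x∈p∪q⁻ X Y (∈-relabel⁻ x∈)))
    (λ x∈ → ∈-relabel⁺ {X ∪ Y} (x∈p∪q⁺ (Sum.map ∈-relabel⁻ ∈-relabel⁻ (x∈p∪q⁻ (relabel π X) (relabel π Y) x∈))))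

  relabel-⁅⁆ : ∀ e → relabel π ⁅ e ⁆ ≡ ⁅ π ⟨$⟩ʳ e ⁆
  relabel-⁅⁆ e = ⊆-antisym
    (λ {x} x∈ → subst (_∈ ⁅ π ⟨$⟩ʳ e ⁆) (trans (cong (π ⟨$⟩ʳ_) (sym (x∈⁅y⁆⇒x≡y e (∈-relabel⁻ x∈)))) (inverseʳ π))
                      (x∈⁅x⁆ _))
    (λ x∈ → subst (_∈ relabel π ⁅ e ⁆) (sym (x∈⁅y⁆⇒x≡y _ x∈)) (∈-relabel-image (x∈⁅x⁆ e)))

column : (Fin r → Fin n → Bool) → Fin n → Fin r → Bool
column A x i = A i x

otherColumns : (Fin r → Fin (suc n) → Bool) → Fin r → Fin n → Bool
otherColumns A i j = A i (suc j)

InSpan : (Fin r → Fin n → Bool) → Subset n → (Fin r → Bool) → Set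
InSpan A X v = ∃ λ W → W ⊆ X × colSum A W ≗ v

colSum-⊥ : (A : Fin r → Fin n → Bool) → colSum A ⊥ ≗ const false
colSum-⊥ {n = zero}  A i = refl
colSum-⊥ {n = suc n} A i = colSum-⊥ (otherColumns A) i

colSum-⁅⁆ : (A : Fin r → Fin n → Bool) (x : Fin n) → colSum A ⁅ x ⁆ ≗ column A x
colSum-⁅⁆ A zero    i = trans (cong (A i zero xor_) (colSum-⊥ (otherColumns A) i)) (xor-identityʳ _)
colSum-⁅⁆ A (suc x) i = colSum-⁅⁆ (otherColumns A) x i

colSum-∪ : (A : Fin r → Fin n → Bool) (Y Z : Subset n) → Disjoint Y Z →
           ∀ i → colSum A (Y ∪ Z) i ≡ colSum A Y i xor colSum A Z i
colSum-∪ A []          []          _    i = refl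
colSum-∪ A (true  ∷ Y) (true  ∷ Z) disj i = contradiction here (disj here)
colSum-∪ A (true  ∷ Y) (false ∷ Z) disj i =
  trans (cong (A i zero xor_) (colSum-∪ (otherColumns A) Y Z (Disjoint-∷⁻ disj) i))
        (sym (xor-assoc (A i zero) (colSum (otherColumns A) Y i) (colSum (otherColumns A) Z i)))
colSum-∪ A (false ∷ Y) (true  ∷ Z) disj i =
  trans (cong (A i zero xor_) (colSum-∪ (otherColumns A) Y Z (Disjoint-∷⁻ disj) i))
        (x∙yz≈y∙xz (A i zero) (colSum (otherColumns A) Y i) (colSum (otherColumns A) Z i))
colSum-∪ A (false ∷ Y) (false ∷ Z) disj i = colSum-∪ (otherColumns A) Y Z (Disjoint-∷⁻ disj) i

InSpan-resp : (A : Fin r → Fin n → Bool) {X : Subset n} {v w : Fin r → Bool} → v ≗ w → InSpan A X v → InSpan A X w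
InSpan-resp A v≗w (W , W⊆X , W≈v) = W , W⊆X , λ i → trans (W≈v i) (v≗w i)

∈⇒InSpan : (A : Fin r → Fin n → Bool) {X : Subset n} {p : Fin n} → p ∈ X → InSpan A X (column A p)
∈⇒InSpan A {p = p} p∈X = ⁅ p ⁆ , (λ x∈ → subst (_∈ _) (sym (x∈⁅y⁆⇒x≡y p x∈)) p∈X) , colSum-⁅⁆ A p

module _ {k : ℕ} (col : Fin k → Fin r → Bool)
         (closed : ∀ f g → f ≢ g → ∃ λ h → ∀ i → col f i xor col g i ≡ col h i) where

  ZeroOrColumn : (Fin r → Bool) → Set
  ZeroOrColumn v = v ≗ const false ⊎ ∃ λ f → v ≗ col f

  ZeroOrColumn-resp : ∀ {v w} → v ≗ w → ZeroOrColumn v → ZeroOrColumn w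
  ZeroOrColumn-resp v≗w (inj₁ v≡0)       = inj₁ λ i → trans (sym (v≗w i)) (v≡0 i)
  ZeroOrColumn-resp v≗w (inj₂ (f , v≡f)) = inj₂ (f , λ i → trans (sym (v≗w i)) (v≡f i))

  ZeroOrColumn-add : ∀ f {v} → ZeroOrColumn v → ZeroOrColumn (λ i → col f i xor v i)
  ZeroOrColumn-add f (inj₁ v≡0) = inj₂ (f , λ i → trans (cong (col f i xor_) (v≡0 i)) (xor-identityʳ _))
  ZeroOrColumn-add f (inj₂ (g , v≡g)) with f ≟ᶠ g
  ... | yes refl = inj₁ λ i → trans (cong (col f i xor_) (v≡g i)) (xor-same (col f i))
  ... | no f≢g   = let h , f+g≡h = closed f g f≢g in
                   inj₂ (h , λ i → trans (cong (col f i xor_) (v≡g i)) (f+g≡h i))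

  colSum-closed : (B : Fin r → Fin m → Bool) (W : Subset m) →
                  (∀ {x} → x ∈ W → ∃ λ f → column B x ≗ col f) → ZeroOrColumn (colSum B W)
  colSum-closed B []          _    = inj₁ λ i → refl
  colSum-closed B (false ∷ W) cols = colSum-closed (otherColumns B) W (cols ∘ there)
  colSum-closed B (true  ∷ W) cols =
    let f , B₀≡f = cols here in
    ZeroOrColumn-resp (λ i → cong (_xor colSum (otherColumns B) W i) (sym (B₀≡f i)))
                      (ZeroOrColumn-add f (colSum-closed (otherColumns B) W (cols ∘ there)))

-- Vector matroids over GF(2)

Dependent : (Fin r → Fin n → Bool) → Subset n → Set
Dependent A X = ∃ λ Y → Y ⊆ X × colSum A Y ≗ const false × Y ≢ ⊥

dependent? : (A : Fin r → Fin n → Bool) → ∀ X → Dec (Dependent A X)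
dependent? A X = anySubset? λ Y → Y ⊆? X ×-dec all? (λ i → colSum A Y i ≟ false) ×-dec ¬? (≡-dec _≟_ Y ⊥)

vecMatroid⇔¬dependent : (A : Fin r → Fin n → Bool) → ∀ X → VecMatroid A X ⇔ (¬ Dependent A X)
vecMatroid⇔¬dependent A X = mk⇔
  (λ indX (Y , Y⊆X , sum≡0 , Y≢⊥) → Y≢⊥ (indX Y Y⊆X sum≡0))
  (λ ¬dep Y Y⊆X sum≡0 → decidable-stable (≡-dec _≟_ Y ⊥) (λ Y≢⊥ → ¬dep (Y , Y⊆X , sum≡0 , Y≢⊥)))

vecMatroid? : (A : Fin r → Fin n → Bool) → ∀ X → Dec (VecMatroid A X)
vecMatroid? A X = map (⇔.sym (vecMatroid⇔¬dependent A X)) (¬? (dependent? A X))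

¬vecMatroid⇒dependent : (A : Fin r → Fin n → Bool) → ∀ {X} → ¬ VecMatroid A X → Dependent A X
¬vecMatroid⇒dependent A {X} ¬indX =
  decidable-stable (dependent? A X) (¬indX ∘ Equivalence.from (vecMatroid⇔¬dependent A X))

vecMatroid-⊥ : (A : Fin r → Fin n → Bool) → VecMatroid A ⊥
vecMatroid-⊥ A Y Y⊆⊥ _ = ⊆-antisym Y⊆⊥ (⊆-min Y)

vecMatroid-mono : (A : Fin r → Fin n → Bool) {X Y : Subset n} → Y ⊆ X → VecMatroid A X → VecMatroid A Y
vecMatroid-mono A Y⊆X indX W W⊆Y = indX W (Y⊆X ∘ W⊆Y)

vecMatroid-∪⁅⁆ : (A : Fin r → Fin n → Bool) {X : Subset n} {p : Fin n} → p ∉ X →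
                 VecMatroid A (X ∪ ⁅ p ⁆) ⇔ (VecMatroid A X × ¬ InSpan A X (column A p))
vecMatroid-∪⁅⁆ A {X} {p} p∉X = mk⇔ to from
  where
  ⊆X⇒Disjoint : ∀ {W} → W ⊆ X → Disjoint W ⁅ p ⁆
  ⊆X⇒Disjoint W⊆X x∈W x∈⁅p⁆ = p∉X (W⊆X (subst (_∈ _) (x∈⁅y⁆⇒x≡y p x∈⁅p⁆) x∈W))

  to : VecMatroid A (X ∪ ⁅ p ⁆) → VecMatroid A X × ¬ InSpan A X (column A p)
  to ind = vecMatroid-mono A (p⊆p∪q ⁅ p ⁆) ind , λ (W , W⊆X , W≈p) →
    ∉⊥ (subst (p ∈_) (ind (W ∪ ⁅ p ⁆) (∪⁅p⁆-mono W⊆X) (sum≡0 W⊆X W≈p)) (x∈p∪q⁺ (inj₂ (x∈⁅x⁆ p))))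
    where
    ∪⁅p⁆-mono : ∀ {W} → W ⊆ X → W ∪ ⁅ p ⁆ ⊆ X ∪ ⁅ p ⁆
    ∪⁅p⁆-mono {W} W⊆X x∈ = [ x∈p∪q⁺ ∘ inj₁ ∘ W⊆X , x∈p∪q⁺ ∘ inj₂ ]′ (x∈p∪q⁻ W ⁅ p ⁆ x∈)
    sum≡0 : ∀ {W} → W ⊆ X → colSum A W ≗ column A p → colSum A (W ∪ ⁅ p ⁆) ≗ const false
    sum≡0 {W} W⊆X W≈p i = begin
      colSum A (W ∪ ⁅ p ⁆) i             ≡⟨ colSum-∪ A W ⁅ p ⁆ (⊆X⇒Disjoint W⊆X) i ⟩
      colSum A W i xor colSum A ⁅ p ⁆ i  ≡⟨ cong₂ _xor_ (W≈p i) (colSum-⁅⁆ A p i) ⟩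
      A i p xor A i p                    ≡⟨ xor-same (A i p) ⟩
      false                              ∎
      where open ≡-Reasoning

  from : VecMatroid A X × ¬ InSpan A X (column A p) → VecMatroid A (X ∪ ⁅ p ⁆)
  from (indX , ¬span) Y Y⊆ sum≡0 with p ∈? Y
  ... | no p∉Y = indX Y Y⊆X sum≡0
    where
    Y⊆X : Y ⊆ X
    Y⊆X x∈Y = [ id , (λ x∈⁅p⁆ → contradiction (subst (_∈ Y) (x∈⁅y⁆⇒x≡y p x∈⁅p⁆) x∈Y) p∉Y) ]′
                (x∈p∪q⁻ X ⁅ p ⁆ (Y⊆ x∈Y))
  ... | yes p∈Y = contradiction (Y - p , (λ {_} → Y-p⊆X) , λ i → xor≡false⇒≡ (sum i)) ¬span
    where
    Y-p⊆X : Y - p ⊆ X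
    Y-p⊆X x∈ = [ id , (λ x∈⁅p⁆ → contradiction x∈⁅p⁆ (x∈p─q⇒x∉q Y ⁅ p ⁆ x∈)) ]′
                 (x∈p∪q⁻ X ⁅ p ⁆ (Y⊆ (p─q⊆p Y ⁅ p ⁆ x∈)))
    sum : ∀ i → colSum A (Y - p) i xor A i p ≡ false
    sum i = begin
      colSum A (Y - p) i xor A i p             ≡⟨ cong (colSum A (Y - p) i xor_) (sym (colSum-⁅⁆ A p i)) ⟩
      colSum A (Y - p) i xor colSum A ⁅ p ⁆ i  ≡⟨ sym (colSum-∪ A (Y - p) ⁅ p ⁆ (x∈p─q⇒x∉q Y ⁅ p ⁆) i) ⟩
      colSum A ((Y - p) ∪ ⁅ p ⁆) i             ≡⟨ cong (λ Z → colSum A Z i) (sym (x∈p⇒p≡p-x∪⁅x⁆ Y p∈Y)) ⟩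
      colSum A Y i                             ≡⟨ sum≡0 i ⟩
      false                                    ∎
      where open ≡-Reasoning

vecMatroid-⁅⁆ : (A : Fin r → Fin n → Bool) {p : Fin n} → ¬ (column A p ≗ const false) → VecMatroid A ⁅ p ⁆
vecMatroid-⁅⁆ A {p} p≢0 = subst (VecMatroid A) (∪-identityˡ ⁅ p ⁆)
  (Equivalence.from (vecMatroid-∪⁅⁆ A ∉⊥) (vecMatroid-⊥ A , λ (W , W⊆⊥ , W≈p) →
    p≢0 λ i → trans (sym (W≈p i)) (subst (λ Z → colSum A Z i ≡ false) (sym (⊆-antisym W⊆⊥ (⊆-min W))) (colSum-⊥ A i))))

vecMatroid-∪-parallel : (A : Fin r → Fin n → Bool) {X : Subset n} {p q : Fin n} → column A p ≗ column A q →
                        p ∉ X → VecMatroid A (X ∪ ⁅ p ⁆) ⇔ (q ∉ X × VecMatroid A (X ∪ ⁅ q ⁆))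
vecMatroid-∪-parallel A {X} {p} {q} p∥q p∉X = mk⇔
  (λ ind → case Equivalence.to (vecMatroid-∪⁅⁆ A p∉X) ind of λ (indX , ¬spanP) →
     let q∉X = λ q∈X → ¬spanP (InSpan-resp A (sym ∘ p∥q) (∈⇒InSpan A q∈X)) in
     q∉X , Equivalence.from (vecMatroid-∪⁅⁆ A q∉X) (indX , ¬spanP ∘ InSpan-resp A (sym ∘ p∥q)))
  (λ (q∉X , ind) → case Equivalence.to (vecMatroid-∪⁅⁆ A q∉X) ind of λ (indX , ¬spanQ) →
     Equivalence.from (vecMatroid-∪⁅⁆ A p∉X) (indX , ¬spanQ ∘ InSpan-resp A p∥q))

circuit-sum≡0 : (A : Fin r → Fin n → Bool) (T : Subset n) → ¬ VecMatroid A T →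
                (∀ {x} → x ∈ T → VecMatroid A (T - x)) → colSum A T ≗ const false
circuit-sum≡0 A T ¬indT indT-x i with ¬vecMatroid⇒dependent A ¬indT
... | Y , Y⊆T , sum≡0 , Y≢⊥ = subst (λ Z → colSum A Z i ≡ false) (⊆-antisym Y⊆T T⊆Y) (sum≡0 i)
  where
  T⊆Y : T ⊆ Y
  T⊆Y {x} x∈T = decidable-stable (x ∈? Y) λ x∉Y →
    Y≢⊥ (indT-x x∈T Y (λ y∈Y → x∈p∧x≢y⇒x∈p-y (Y⊆T y∈Y) (λ { refl → x∉Y y∈Y })) sum≡0)

triangle-sum : (A : Fin r → Fin n → Bool) {f g h : Fin n} → f ≢ g → f ≢ h → g ≢ h →
               VecMatroid A (⁅ f ⁆ ∪ ⁅ g ⁆) → VecMatroid A (⁅ f ⁆ ∪ ⁅ h ⁆) → VecMatroid A (⁅ g ⁆ ∪ ⁅ h ⁆) →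
               ¬ VecMatroid A (⁅ f ⁆ ∪ ⁅ g ⁆ ∪ ⁅ h ⁆) → ∀ i → A i f xor A i g ≡ A i h
triangle-sum {n = n} A {f} {g} {h} f≢g f≢h g≢h indFG indFH indGH ¬indT i =
  xor≡false⇒≡ (trans (xor-assoc (A i f) (A i g) (A i h)) (trans (sym sumT) (circuit-sum≡0 A T ¬indT minimal i)))
  where
  T : Subset n
  T = ⁅ f ⁆ ∪ ⁅ g ⁆ ∪ ⁅ h ⁆

  sumT : colSum A T i ≡ A i f xor (A i g xor A i h)
  sumT = begin
    colSum A T i                                       ≡⟨ colSum-∪ A ⁅ f ⁆ _ f∉gh i ⟩
    colSum A ⁅ f ⁆ i xor colSum A (⁅ g ⁆ ∪ ⁅ h ⁆) i  ≡⟨ cong (colSum A ⁅ f ⁆ i xor_) (colSum-∪ A ⁅ g ⁆ ⁅ h ⁆ (⁅⁆-disjoint g≢h) i) ⟩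
    colSum A ⁅ f ⁆ i xor (colSum A ⁅ g ⁆ i xor colSum A ⁅ h ⁆ i)
      ≡⟨ cong₂ _xor_ (colSum-⁅⁆ A f i) (cong₂ _xor_ (colSum-⁅⁆ A g i) (colSum-⁅⁆ A h i)) ⟩
    A i f xor (A i g xor A i h)                        ∎
    where
    open ≡-Reasoning
    f∉gh : Disjoint ⁅ f ⁆ (⁅ g ⁆ ∪ ⁅ h ⁆)
    f∉gh x∈f x∈gh = [ ⁅⁆-disjoint f≢g x∈f , ⁅⁆-disjoint f≢h x∈f ]′ (x∈p∪q⁻ ⁅ g ⁆ ⁅ h ⁆ x∈gh)

  others : ∀ {x y} → y ∈ T - x → (y ≡ f ⊎ y ≡ g ⊎ y ≡ h) × y ≢ x
  others {x} y∈ = ∈-triple⁻ (p─q⊆p T ⁅ x ⁆ y∈) , λ { refl → x∈p─q⇒x∉q T ⁅ x ⁆ y∈ (x∈⁅x⁆ x) }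

  minimal : ∀ {x} → x ∈ T → VecMatroid A (T - x)
  minimal x∈T with ∈-triple⁻ x∈T
  ... | inj₁ refl = vecMatroid-mono A (λ y∈ → ∈-pair⁺ (case others y∈ of λ where
          (inj₁ y≡f , y≢f)          → contradiction y≡f y≢f
          (inj₂ y≡g⊎h , _)          → y≡g⊎h)) indGH
  ... | inj₂ (inj₁ refl) = vecMatroid-mono A (λ y∈ → ∈-pair⁺ (case others y∈ of λ where
          (inj₁ y≡f , _)            → inj₁ y≡f
          (inj₂ (inj₁ y≡g) , y≢g)   → contradiction y≡g y≢g
          (inj₂ (inj₂ y≡h) , _)     → inj₂ y≡h)) indFH
  ... | inj₂ (inj₂ refl) = vecMatroid-mono A (λ y∈ → ∈-pair⁺ (case others y∈ of λ where
          (inj₁ y≡f , _)            → inj₁ y≡f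
          (inj₂ (inj₁ y≡g) , _)     → inj₂ y≡g
          (inj₂ (inj₂ y≡h) , y≢h)   → contradiction y≡h y≢h)) indFG

-- Contraction of u that keeps u in the ground set, as a loop.
contractAt : SetSystem n → Fin n → SetSystem n
contractAt M u S = u ∉ S × M (S ∪ ⁅ u ⁆)

≅-resp-⇔ : {M M′ : SetSystem n} {F : SetSystem m} → (∀ X → M X ⇔ M′ X) → M′ ≅ F → M ≅ F
≅-resp-⇔ M⇔M′ (π , iso) = π , λ X →
  proj₁ (iso X) ∘ Equivalence.to (M⇔M′ X) , Equivalence.from (M⇔M′ X) ∘ proj₂ (iso X)

≅⇒hasMinorIso : {M : SetSystem n} {F : SetSystem m} → M ≅ F → HasMinorIso M F
≅⇒hasMinorIso {M = M} M≅F = _ , M , self , M≅F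

contractAt-relabel : (π : Permutation n m) {M : SetSystem n} {M′ : SetSystem m} →
                     (∀ X → M X ⇔ M′ (relabel π X)) →
                     ∀ e X → contractAt M e X ⇔ contractAt M′ (π ⟨$⟩ʳ e) (relabel π X)
contractAt-relabel π {M′ = M′} M⇔M′ e X =
  ¬-cong-⇔ (mk⇔ (∈-relabel-image π) (subst (_∈ X) (inverseˡ π) ∘ ∈-relabel⁻ π))
  ×-⇔ ⇔.trans (M⇔M′ (X ∪ ⁅ e ⁆)) (≡⇒⇔ M′ (trans (relabel-∪ π X ⁅ e ⁆) (cong (relabel π X ∪_) (relabel-⁅⁆ π e))))

mapCycle : ∀ {v k} {ends : Fin n → Fin v × Fin v} {ends′ : Fin m → Fin v × Fin v} {X Y} (h : Fin n → Fin m) →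
           Injective _≡_ _≡_ h → (∀ e → ends′ (h e) ≡ ends e) → (∀ {e} → e ∈ X → h e ∈ Y) →
           Cycle (record { nV = v ; ends = ends }) X k → Cycle (record { nV = v ; ends = ends′ }) Y k
mapCycle h h-inj ends-h h-∈ cycle = record
  { es = h ∘ es ; ws = ws ; es-inj = es-inj ∘ h-inj ; ws-inj = ws-inj ; closed = closed
  ; es-in = h-∈ ∘ es-in ; joins = λ i → Sum.map (trans (ends-h (es i))) (trans (ends-h (es i))) (joins i) }
  where open Cycle cycle

graphic-relabel : (π : Permutation n m) {M : SetSystem n} {M′ : SetSystem m} →
                  (∀ X → M X ⇔ M′ (relabel π X)) → Graphic M′ → Graphic M
graphic-relabel {n = n} π M⇔M′ (G′ , M′-cycles) = G , λ X →
  Equivalence.from (acyclic⇔ X) ∘ proj₁ (M′-cycles _) ∘ Equivalence.to (M⇔M′ X) ,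
  Equivalence.from (M⇔M′ X) ∘ proj₂ (M′-cycles _) ∘ Equivalence.to (acyclic⇔ X)
  where
  G : Graph n
  G = record { nV = Graph.nV G′ ; ends = Graph.ends G′ ∘ (π ⟨$⟩ʳ_) }
  acyclic⇔ : ∀ X → CycleMatroid G X ⇔ CycleMatroid G′ (relabel π X)
  acyclic⇔ X = mk⇔
    (λ acyclic (k , cycle) → acyclic (k , mapCycle (π ⟨$⟩ˡ_) (Injection.injective (↔⇒↣ (flip π)))
                                            (λ _ → cong (Graph.ends G′) (inverseʳ π)) (∈-relabel⁻ π) cycle))
    (λ acyclic′ (k , cycle) → acyclic′ (k , mapCycle (π ⟨$⟩ʳ_) (Injection.injective (↔⇒↣ π))
                                              (λ _ → refl) (∈-relabel-image π) cycle))

-- Multigraphs on a triangle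

_≟ₘ_ : (c c′ : Maybe (Fin 3)) → Dec (c ≡ c′)
_≟ₘ_ = ≡-decₘ _≟ᶠ_

next : Fin 3 → Fin 3
next zero             = suc zero
next (suc zero)       = suc (suc zero)
next (suc (suc zero)) = zero

next-≢ : ∀ k → k ≢ next k
next-≢ zero             ()
next-≢ (suc zero)       ()
next-≢ (suc (suc zero)) ()

edgeEnds : Maybe (Fin 3) → Fin 3 × Fin 3
edgeEnds nothing  = zero , zero
edgeEnds (just k) = k , next k

triangleGraph : (Fin n → Maybe (Fin 3)) → Graph n
triangleGraph c = record { nV = 3 ; ends = edgeEnds ∘ c }

edgeClass : Fin 3 × Fin 3 → Maybe (Fin 3)
edgeClass (zero           , suc zero)       = just zero
edgeClass (suc zero       , zero)           = just zero
edgeClass (suc zero       , suc (suc zero)) = just (suc zero)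
edgeClass (suc (suc zero) , suc zero)       = just (suc zero)
edgeClass (suc (suc zero) , zero)           = just (suc (suc zero))
edgeClass (zero           , suc (suc zero)) = just (suc (suc zero))
edgeClass _                                 = nothing

edgeClass-edgeEnds : ∀ c → edgeClass (edgeEnds c) ≡ c
edgeClass-edgeEnds nothing                 = refl
edgeClass-edgeEnds (just zero)             = refl
edgeClass-edgeEnds (just (suc zero))       = refl
edgeClass-edgeEnds (just (suc (suc zero))) = refl

edgeClass-swap : ∀ x y → edgeClass (x , y) ≡ edgeClass (y , x)
edgeClass-swap = toWitness {a? = all? λ x → all? λ y → edgeClass (x , y) ≟ₘ edgeClass (y , x)} tt

edgeClass-loop : ∀ x → edgeClass (x , x) ≡ nothing
edgeClass-loop zero             = refl
edgeClass-loop (suc zero)       = refl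
edgeClass-loop (suc (suc zero)) = refl

distinct-exhaust-Fin3 : ∀ (i j k t : Fin 3) → i ≢ j → i ≢ k → j ≢ k → t ≡ i ⊎ t ≡ j ⊎ t ≡ k
distinct-exhaust-Fin3 = toWitness {a? = all? λ i → all? λ j → all? λ k → all? λ t →
  ¬? (i ≟ᶠ j) →-dec ¬? (i ≟ᶠ k) →-dec ¬? (j ≟ᶠ k) →-dec (t ≟ᶠ i ⊎-dec t ≟ᶠ j ⊎-dec t ≟ᶠ k)} tt

Forest : (Fin n → Maybe (Fin 3)) → Subset n → Set
Forest c X = (∀ f → f ∈ X → c f ≢ nothing)
           × (∀ f → f ∈ X → ∀ g → g ∈ X → f ≢ g → c f ≢ c g)
           × (∀ f → f ∈ X → ∀ g → g ∈ X → ∀ h → h ∈ X → f ≢ g → f ≢ h → g ≢ h → Empty)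

forest? : (c : Fin n → Maybe (Fin 3)) → ∀ X → Dec (Forest c X)
forest? c X = all? (λ f → f ∈? X →-dec ¬? (c f ≟ₘ nothing))
       ×-dec all? (λ f → f ∈? X →-dec all? λ g → g ∈? X →-dec ¬? (f ≟ᶠ g) →-dec ¬? (c f ≟ₘ c g))
       ×-dec all? (λ f → f ∈? X →-dec all? λ g → g ∈? X →-dec all? λ h → h ∈? X →-dec
                         ¬? (f ≟ᶠ g) →-dec ¬? (f ≟ᶠ h) →-dec ¬? (g ≟ᶠ h) →-dec no λ ())

module _ {n : ℕ} (c : Fin n → Maybe (Fin 3)) (X : Subset n) where

  private
    G : Graph n
    G = triangleGraph c

  joins⇒edgeClass : ∀ {e x y} → Joins G e x y → c e ≡ edgeClass (x , y)
  joins⇒edgeClass {e} (inj₁ eq) = trans (sym (edgeClass-edgeEnds (c e))) (cong edgeClass eq)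
  joins⇒edgeClass {e} {x} {y} (inj₂ eq) =
    trans (sym (edgeClass-edgeEnds (c e))) (trans (cong edgeClass eq) (edgeClass-swap y x))

  loop-cycle : ∀ {f} → f ∈ X → c f ≡ nothing → Cycle G X 0
  loop-cycle {f} f∈X cf = record
    { es = λ _ → f ; ws = λ _ → zero
    ; es-inj = λ { {zero} {zero} _ → refl } ; ws-inj = λ { {zero} {zero} _ → refl }
    ; closed = refl ; es-in = λ _ → f∈X ; joins = λ _ → inj₁ (cong edgeEnds cf) }

  parallel-cycle : ∀ {f g k} → f ∈ X → g ∈ X → f ≢ g → c f ≡ just k → c g ≡ just k → Cycle G X 1
  parallel-cycle {f} {g} {k} f∈X g∈X f≢g cf cg = record
    { es = es ; ws = ws ; es-inj = es-inj ; ws-inj = ws-inj ; closed = refl ; es-in = es-in ; joins = joins }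
    where
    es : Fin 2 → Fin n
    es zero       = f
    es (suc zero) = g
    ws : Fin 3 → Fin 3
    ws (suc zero) = next k
    ws _          = k
    es-inj : ∀ {i j} → es i ≡ es j → i ≡ j
    es-inj {zero}     {zero}     _ = refl
    es-inj {zero}     {suc zero} e = contradiction e f≢g
    es-inj {suc zero} {zero}     e = contradiction (sym e) f≢g
    es-inj {suc zero} {suc zero} _ = refl
    ws-inj : ∀ {i j : Fin 2} → ws (inject₁ i) ≡ ws (inject₁ j) → i ≡ j
    ws-inj {zero}     {zero}     _ = refl
    ws-inj {zero}     {suc zero} e = contradiction e (next-≢ k)
    ws-inj {suc zero} {zero}     e = contradiction (sym e) (next-≢ k)
    ws-inj {suc zero} {suc zero} _ = refl
    es-in : ∀ i → es i ∈ X
    es-in zero       = f∈X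
    es-in (suc zero) = g∈X
    joins : ∀ i → Joins G (es i) (ws (inject₁ i)) (ws (suc i))
    joins zero       = inj₁ (cong edgeEnds cf)
    joins (suc zero) = inj₂ (cong edgeEnds cg)

  triangle-cycle : (es : Fin 3 → Fin n) → (∀ i → es i ∈ X) → (∀ i → c (es i) ≡ just i) → Cycle G X 2
  triangle-cycle es es-in ces = record
    { es = es ; ws = ws ; es-inj = es-inj ; ws-inj = ws-inj ; closed = refl ; es-in = es-in ; joins = joins }
    where
    ws : Fin 4 → Fin 3
    ws zero                   = zero
    ws (suc zero)             = suc zero
    ws (suc (suc zero))       = suc (suc zero)
    ws (suc (suc (suc zero))) = zero
    ws-inject₁ : ∀ i → ws (inject₁ i) ≡ i
    ws-inject₁ zero             = refl
    ws-inject₁ (suc zero)       = refl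
    ws-inject₁ (suc (suc zero)) = refl
    ws-inj : ∀ {i j} → ws (inject₁ i) ≡ ws (inject₁ j) → i ≡ j
    ws-inj {i} {j} e = trans (sym (ws-inject₁ i)) (trans e (ws-inject₁ j))
    es-inj : ∀ {i j} → es i ≡ es j → i ≡ j
    es-inj {i} {j} e = just-injective (trans (sym (ces i)) (trans (cong c e) (ces j)))
    joins : ∀ i → Joins G (es i) (ws (inject₁ i)) (ws (suc i))
    joins zero             = inj₁ (cong edgeEnds (ces zero))
    joins (suc zero)       = inj₁ (cong edgeEnds (ces (suc zero)))
    joins (suc (suc zero)) = inj₁ (cong edgeEnds (ces (suc (suc zero))))

  acyclic⇒forest : CycleMatroid G X → Forest c X
  acyclic⇒forest acyclic = no-loop , no-parallel , no-triangle
    where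
    no-loop : ∀ f → f ∈ X → c f ≢ nothing
    no-loop f f∈X cf = acyclic (0 , loop-cycle f∈X cf)

    no-parallel : ∀ f → f ∈ X → ∀ g → g ∈ X → f ≢ g → c f ≢ c g
    no-parallel f f∈X g g∈X f≢g cf≡cg with c f in cf
    ... | nothing = no-loop f f∈X cf
    ... | just k  = acyclic (1 , parallel-cycle f∈X g∈X f≢g cf (sym cf≡cg))

    no-triangle : ∀ f → f ∈ X → ∀ g → g ∈ X → ∀ h → h ∈ X → f ≢ g → f ≢ h → g ≢ h → Empty
    no-triangle f f∈X g g∈X h h∈X f≢g f≢h g≢h with c f in cf | c g in cg | c h in ch
    ... | nothing | _       | _       = no-loop f f∈X cf
    ... | just _  | nothing | _       = no-loop g g∈X cg
    ... | just _  | just _  | nothing = no-loop h h∈X ch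
    ... | just i  | just j  | just k  =
      acyclic (2 , triangle-cycle (proj₁ ∘ edgeOfClass) (proj₁ ∘ proj₂ ∘ edgeOfClass) (proj₂ ∘ proj₂ ∘ edgeOfClass))
      where
      classes-≢ : ∀ {x y} {i j : Fin 3} → x ∈ X → y ∈ X → x ≢ y → c x ≡ just i → c y ≡ just j → i ≢ j
      classes-≢ x∈X y∈X x≢y cx cy refl = no-parallel _ x∈X _ y∈X x≢y (trans cx (sym cy))
      edgeOfClass : ∀ t → Σ (Fin n) λ e → e ∈ X × c e ≡ just t
      edgeOfClass t with distinct-exhaust-Fin3 i j k t (classes-≢ f∈X g∈X f≢g cf cg)
                           (classes-≢ f∈X h∈X f≢h cf ch) (classes-≢ g∈X h∈X g≢h cg ch)
      ... | inj₁ refl        = f , f∈X , cf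
      ... | inj₂ (inj₁ refl) = g , g∈X , cg
      ... | inj₂ (inj₂ refl) = h , h∈X , ch

  forest⇒acyclic : Forest c X → CycleMatroid G X
  forest⇒acyclic (no-loop , _ , _) (zero , cycle) = no-loop (es zero) (es-in zero)
    (trans (joins⇒edgeClass (subst (Joins G (es zero) (ws zero)) closed (joins zero))) (edgeClass-loop (ws zero)))
    where open Cycle cycle
  forest⇒acyclic (_ , no-parallel , _) (suc zero , cycle) =
    no-parallel (es zero) (es-in zero) (es (suc zero)) (es-in (suc zero)) (λ e → case es-inj e of λ ())
      (trans (joins⇒edgeClass (joins zero))
        (trans (edgeClass-swap (ws zero) (ws (suc zero)))
          (sym (joins⇒edgeClass (subst (Joins G (es (suc zero)) (ws (suc zero))) closed (joins (suc zero)))))))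
    where open Cycle cycle
  forest⇒acyclic (_ , _ , no-triangle) (suc (suc k) , cycle) =
    no-triangle (es zero) (es-in zero) (es (suc zero)) (es-in (suc zero)) (es (suc (suc zero))) (es-in (suc (suc zero)))
      (λ e → case es-inj e of λ ()) (λ e → case es-inj e of λ ()) (λ e → case es-inj e of λ ())
    where open Cycle cycle

  cycleMatroid⇔forest : CycleMatroid G X ⇔ Forest c X
  cycleMatroid⇔forest = mk⇔ acyclic⇒forest forest⇒acyclic

-- The Fano plane

fanoLines : List (Subset 7)
fanoLines = (true  ∷ true  ∷ true  ∷ false ∷ false ∷ false ∷ false ∷ [])
          ∷ (true  ∷ false ∷ false ∷ true  ∷ true  ∷ false ∷ false ∷ [])
          ∷ (true  ∷ false ∷ false ∷ false ∷ false ∷ true  ∷ true  ∷ [])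
          ∷ (false ∷ true  ∷ false ∷ true  ∷ false ∷ true  ∷ false ∷ [])
          ∷ (false ∷ true  ∷ false ∷ false ∷ true  ∷ false ∷ true  ∷ [])
          ∷ (false ∷ false ∷ true  ∷ true  ∷ false ∷ false ∷ true  ∷ [])
          ∷ (false ∷ false ∷ true  ∷ false ∷ true  ∷ true  ∷ false ∷ [])
          ∷ []

FanoIndependent : Subset 7 → Set
FanoIndependent S = ∣ S ∣ ≤ 2 ⊎ (∣ S ∣ ≡ 3 × S ∉ₗ fanoLines)

fanoIndependent? : ∀ S → Dec (FanoIndependent S)
fanoIndependent? S = ∣ S ∣ ≤? 2 ⊎-dec (∣ S ∣ ≟ℕ 3 ×-dec ¬? (S ∈ₗ? fanoLines))

F7? : ∀ S → Dec (F7 S)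
F7? = vecMatroid? (λ i j → lookup (lookup fanoRows i) j)

-- lineClass u l says which of the three lines through u (numbered in the order of fanoLines)
-- contains l, and is nothing for l = u.
lineClass : Fin 7 → Fin 7 → Maybe (Fin 3)
lineClass u l = lookup (lookup table u) l
  where
  ○ ₀ ₁ ₂ : Maybe (Fin 3)
  ○ = nothing
  ₀ = just zero
  ₁ = just (suc zero)
  ₂ = just (suc (suc zero))
  table : Vec (Vec (Maybe (Fin 3)) 7) 7
  table = (○ ∷ ₀ ∷ ₀ ∷ ₁ ∷ ₁ ∷ ₂ ∷ ₂ ∷ [])
        ∷ (₀ ∷ ○ ∷ ₀ ∷ ₁ ∷ ₂ ∷ ₁ ∷ ₂ ∷ [])
        ∷ (₀ ∷ ₀ ∷ ○ ∷ ₁ ∷ ₂ ∷ ₂ ∷ ₁ ∷ [])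
        ∷ (₀ ∷ ₁ ∷ ₂ ∷ ○ ∷ ₀ ∷ ₁ ∷ ₂ ∷ [])
        ∷ (₀ ∷ ₁ ∷ ₂ ∷ ₀ ∷ ○ ∷ ₂ ∷ ₁ ∷ [])
        ∷ (₀ ∷ ₁ ∷ ₂ ∷ ₁ ∷ ₂ ∷ ○ ∷ ₀ ∷ [])
        ∷ (₀ ∷ ₁ ∷ ₂ ∷ ₂ ∷ ₁ ∷ ₀ ∷ ○ ∷ [])
        ∷ []

-- Proved by evaluation; opaque so that type checking never unfolds the decision procedures.
opaque
  F7⇔fanoIndependent : ∀ S → F7 S ⇔ FanoIndependent S
  F7⇔fanoIndependent = toWitness {a? = allSubsets? λ S → F7? S ⇔-dec fanoIndependent? S} tt

  F7-pair : ∀ l₁ l₂ → l₁ ≢ l₂ → F7 (⁅ l₁ ⁆ ∪ ⁅ l₂ ⁆)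
  F7-pair = toWitness {a? = all? λ l₁ → all? λ l₂ → ¬? (l₁ ≟ᶠ l₂) →-dec F7? (⁅ l₁ ⁆ ∪ ⁅ l₂ ⁆)} tt

  F7-line : ∀ l₁ l₂ → l₁ ≢ l₂ → ∃ λ l₃ → l₁ ≢ l₃ × l₂ ≢ l₃ × ¬ F7 (⁅ l₁ ⁆ ∪ ⁅ l₂ ⁆ ∪ ⁅ l₃ ⁆)
  F7-line = toWitness {a? = all? λ l₁ → all? λ l₂ → ¬? (l₁ ≟ᶠ l₂) →-dec
    any? (λ l₃ → ¬? (l₁ ≟ᶠ l₃) ×-dec ¬? (l₂ ≟ᶠ l₃) ×-dec ¬? (F7? (⁅ l₁ ⁆ ∪ ⁅ l₂ ⁆ ∪ ⁅ l₃ ⁆)))} tt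

  fanoContraction⇔forest : ∀ u S → (u ∉ S × FanoIndependent (S ∪ ⁅ u ⁆)) ⇔ Forest (lineClass u) S
  fanoContraction⇔forest = toWitness {a? = all? λ u → allSubsets? λ S →
    (¬? (u ∈? S) ×-dec fanoIndependent? (S ∪ ⁅ u ⁆)) ⇔-dec forest? (lineClass u) S} tt

contractAt-F7-graphic : ∀ u → Graphic (contractAt F7 u)
contractAt-F7-graphic u = triangleGraph (lineClass u) , λ S → Equivalence.to (cycles⇔ S) , Equivalence.from (cycles⇔ S)
  where
  cycles⇔ : ∀ S → contractAt F7 u S ⇔ CycleMatroid (triangleGraph (lineClass u)) S
  cycles⇔ S = ⇔.trans (⇔.refl ×-⇔ F7⇔fanoIndependent (S ∪ ⁅ u ⁆))
                (⇔.trans (fanoContraction⇔forest u S) (⇔.sym (cycleMatroid⇔forest (lineClass u) S)))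

-- Single-element extensions of a binary matroid

module BinaryExtension {n r : ℕ} (N : SetSystem (suc n)) (a : Fin (suc n)) (A : Fin r → Fin (suc n) → Bool)
                       (rep : ∀ X → (N X → VecMatroid A X) × (VecMatroid A X → N X)) where

  private
    toVec : ∀ {X} → N X → VecMatroid A X
    toVec = proj₁ (rep _)
    fromVec : ∀ {X} → VecMatroid A X → N X
    fromVec = proj₂ (rep _)

  con⇔del-of-loop : column A a ≗ const false → ∀ X → con N a X ⇔ del N a X
  con⇔del-of-loop a≡0 X = mk⇔ proj₁ λ d → d , λ N⁅a⁆ →
    contradiction (subst (a ∈_) (toVec N⁅a⁆ ⁅ a ⁆ id (λ i → trans (colSum-⁅⁆ A a i) (a≡0 i))) (x∈⁅x⁆ a)) ∉⊥

  con⇔del-of-coloop : (∀ X → ¬ InSpan A (insertAt X a false) (column A a)) → ∀ X → con N a X ⇔ del N a X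
  con⇔del-of-coloop ¬span X = mk⇔ proj₁ λ d → d , λ _ → fromVec (subst (VecMatroid A) (sym (insertAt-true X a))
    (Equivalence.from (vecMatroid-∪⁅⁆ A (∉-insertAt X a)) (toVec d , ¬span X)))

  con⇔contractAt-del-of-parallel : ¬ (column A a ≗ const false) → ∀ {e} → column A a ≗ column A (punchIn a e) →
                                   ∀ X → con N a X ⇔ contractAt (del N a) e X
  con⇔contractAt-del-of-parallel a≢0 {e} a∥e X = begin
    con N a X
      ∼⟨ mk⇔ (λ (_ , ext) → toVec (ext (fromVec (vecMatroid-⁅⁆ A a≢0))))
             (λ ind → fromVec (vecMatroid-mono A (p⊆p∪q ⁅ a ⁆) (subst (VecMatroid A) (insertAt-true X a) ind))
                    , λ _ → fromVec ind) ⟩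
    VecMatroid A (insertAt X a true)
      ∼⟨ ≡⇒⇔ (VecMatroid A) (insertAt-true X a) ⟩
    VecMatroid A (insertAt X a false ∪ ⁅ a ⁆)
      ∼⟨ vecMatroid-∪-parallel A a∥e (∉-insertAt X a) ⟩
    (punchIn a e ∉ insertAt X a false × VecMatroid A (insertAt X a false ∪ ⁅ punchIn a e ⁆))
      ∼⟨ ¬-cong-⇔ (⇔.sym (∈⇔punchIn-∈-insertAt X a))
         ×-⇔ ⇔.trans (≡⇒⇔ (VecMatroid A) (sym (trans (insertAt-∪ X ⁅ e ⁆ a) (cong (_ ∪_) (insertAt-⁅⁆ e a)))))
                     (mk⇔ fromVec toVec) ⟩
    contractAt (del N a) e X ∎
    where open EquationalReasoning

module FanoDeletion {n r : ℕ} (N : SetSystem (suc n)) (a : Fin (suc n)) (A : Fin r → Fin (suc n) → Bool)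
                    (rep : ∀ X → (N X → VecMatroid A X) × (VecMatroid A X → N X)) (π : Permutation n 7)
                    (iso : ∀ X → (del N a X → F7 (relabel π X)) × (F7 (relabel π X) → del N a X)) where

  open BinaryExtension N a A rep public

  point : Fin 7 → Fin (suc n)
  point l = punchIn a (π ⟨$⟩ˡ l)

  del⇔F7 : ∀ X → del N a X ⇔ F7 (relabel π X)
  del⇔F7 X = mk⇔ (proj₁ (iso X)) (proj₂ (iso X))

  private
    transport : ∀ {X P Q} → insertAt X a false ≡ P → relabel π X ≡ Q → VecMatroid A P ⇔ F7 Q
    transport {X} eqP eqQ =
      ⇔.trans (≡⇒⇔ (VecMatroid A) (sym eqP)) (⇔.trans (mk⇔ (proj₂ (rep _)) (proj₁ (rep _)))
        (⇔.trans (del⇔F7 X) (≡⇒⇔ F7 eqQ)))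

    insertAt-pair : ∀ l₁ l₂ → insertAt (⁅ π ⟨$⟩ˡ l₁ ⁆ ∪ ⁅ π ⟨$⟩ˡ l₂ ⁆) a false ≡ ⁅ point l₁ ⁆ ∪ ⁅ point l₂ ⁆
    insertAt-pair l₁ l₂ = trans (insertAt-∪ ⁅ π ⟨$⟩ˡ l₁ ⁆ ⁅ π ⟨$⟩ˡ l₂ ⁆ a)
                                (cong₂ _∪_ (insertAt-⁅⁆ (π ⟨$⟩ˡ l₁) a) (insertAt-⁅⁆ (π ⟨$⟩ˡ l₂) a))

    relabel-point : ∀ l → relabel π ⁅ π ⟨$⟩ˡ l ⁆ ≡ ⁅ l ⁆
    relabel-point l = trans (relabel-⁅⁆ π (π ⟨$⟩ˡ l)) (cong ⁅_⁆ (inverseʳ π))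

    relabel-pair : ∀ l₁ l₂ → relabel π (⁅ π ⟨$⟩ˡ l₁ ⁆ ∪ ⁅ π ⟨$⟩ˡ l₂ ⁆) ≡ ⁅ l₁ ⁆ ∪ ⁅ l₂ ⁆
    relabel-pair l₁ l₂ = trans (relabel-∪ π ⁅ π ⟨$⟩ˡ l₁ ⁆ ⁅ π ⟨$⟩ˡ l₂ ⁆) (cong₂ _∪_ (relabel-point l₁) (relabel-point l₂))

  pair⇔F7 : ∀ l₁ l₂ → VecMatroid A (⁅ point l₁ ⁆ ∪ ⁅ point l₂ ⁆) ⇔ F7 (⁅ l₁ ⁆ ∪ ⁅ l₂ ⁆)
  pair⇔F7 l₁ l₂ = transport (insertAt-pair l₁ l₂) (relabel-pair l₁ l₂)

  triple⇔F7 : ∀ l₁ l₂ l₃ → VecMatroid A (⁅ point l₁ ⁆ ∪ ⁅ point l₂ ⁆ ∪ ⁅ point l₃ ⁆) ⇔ F7 (⁅ l₁ ⁆ ∪ ⁅ l₂ ⁆ ∪ ⁅ l₃ ⁆)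
  triple⇔F7 l₁ l₂ l₃ = transport
    (trans (insertAt-∪ ⁅ π ⟨$⟩ˡ l₁ ⁆ pair₂₃ a) (cong₂ _∪_ (insertAt-⁅⁆ (π ⟨$⟩ˡ l₁) a) (insertAt-pair l₂ l₃)))
    (trans (relabel-∪ π ⁅ π ⟨$⟩ˡ l₁ ⁆ pair₂₃) (cong₂ _∪_ (relabel-point l₁) (relabel-pair l₂ l₃)))
    where
    pair₂₃ : Subset n
    pair₂₃ = ⁅ π ⟨$⟩ˡ l₂ ⁆ ∪ ⁅ π ⟨$⟩ˡ l₃ ⁆

  point-≢ : ∀ {l₁ l₂} → l₁ ≢ l₂ → point l₁ ≢ point l₂
  point-≢ l₁≢l₂ = l₁≢l₂ ∘ Injection.injective (↔⇒↣ (flip π)) ∘ punchIn-injective a _ _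

  point-columns-closed : ∀ l₁ l₂ → l₁ ≢ l₂ → ∃ λ l₃ → ∀ i → A i (point l₁) xor A i (point l₂) ≡ A i (point l₃)
  point-columns-closed l₁ l₂ l₁≢l₂ = third-point (F7-line l₁ l₂ l₁≢l₂)
    where
    pair : ∀ {l l′} → l ≢ l′ → VecMatroid A (⁅ point l ⁆ ∪ ⁅ point l′ ⁆)
    pair {l} {l′} l≢l′ = Equivalence.from (pair⇔F7 l l′) (F7-pair l l′ l≢l′)
    third-point : (∃ λ l₃ → l₁ ≢ l₃ × l₂ ≢ l₃ × ¬ F7 (⁅ l₁ ⁆ ∪ ⁅ l₂ ⁆ ∪ ⁅ l₃ ⁆)) →
                  ∃ λ l₃ → ∀ i → A i (point l₁) xor A i (point l₂) ≡ A i (point l₃)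
    third-point (l₃ , l₁≢l₃ , l₂≢l₃ , ¬indL) =
      l₃ , triangle-sum A (point-≢ l₁≢l₂) (point-≢ l₁≢l₃) (point-≢ l₂≢l₃) (pair l₁≢l₂) (pair l₁≢l₃) (pair l₂≢l₃)
                        (¬indL ∘ Equivalence.to (triple⇔F7 l₁ l₂ l₃))

  ∈-insertAt⇒point : ∀ {X x} → x ∈ insertAt X a false → ∃ λ l → column A x ≗ column A (point l)
  ∈-insertAt⇒point {X} {x} x∈ = π ⟨$⟩ʳ j , λ i → cong (A i) x≡point
    where
    a≢x : a ≢ x
    a≢x refl = ∉-insertAt X a x∈
    j : Fin n
    j = punchOut a≢x
    x≡point : x ≡ point (π ⟨$⟩ʳ j)
    x≡point = trans (sym (punchIn-punchOut a≢x)) (cong (punchIn a) (sym (inverseˡ π)))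

  ¬InSpan-of-nonparallel : ¬ (column A a ≗ const false) → (∀ l → ¬ (column A a ≗ column A (point l))) →
                           ∀ X → ¬ InSpan A (insertAt X a false) (column A a)
  ¬InSpan-of-nonparallel a≢0 a∦ X (W , W⊆ , W≈a) =
    [ (λ W≈0 → a≢0 λ i → trans (sym (W≈a i)) (W≈0 i)) , (λ (l , W≈l) → a∦ l λ i → trans (sym (W≈a i)) (W≈l i)) ]′
      (colSum-closed (column A ∘ point) point-columns-closed A W (∈-insertAt⇒point ∘ W⊆))

lemma2p10 : (n : ℕ) (N : SetSystem (suc n)) (a : Fin (suc n)) →
    IsMatroid N → Binary N → del N a ≅ F7 →
    ¬ HasMinorIso (con N a) F7 → ¬ HasMinorIso (con N a) F7* →
    Graphic (con N a)
lemma2p10 n N a _ (r , A , rep) (π , iso) noF7 _ = graphic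
  where
  open FanoDeletion N a A rep π iso

  con≇del : ¬ (∀ X → con N a X ⇔ del N a X)
  con≇del con⇔del = noF7 (≅⇒hasMinorIso {F = F7} (≅-resp-⇔ {M′ = del N a} {F = F7} con⇔del (π , iso)))

  graphic : Graphic (con N a)
  graphic with all? (λ i → A i a ≟ false)
  ... | yes a≡0 = contradiction (con⇔del-of-loop a≡0) con≇del
  ... | no a≢0 with any? (λ l → all? λ i → A i a ≟ A i (point l))
  ...   | yes (l , a∥l) = graphic-relabel π
          (λ X → ⇔.trans (con⇔contractAt-del-of-parallel a≢0 a∥l X) (contractAt-relabel π {M′ = F7} del⇔F7 (π ⟨$⟩ˡ l) X))
          (contractAt-F7-graphic (π ⟨$⟩ʳ (π ⟨$⟩ˡ l)))
  ...   | no a∦ = contradiction (con⇔del-of-coloop (¬InSpan-of-nonparallel a≢0 λ l a∥l → a∦ (l , a∥l))) con≇del
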